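{- Let $t \geq 2$ be an integer, let $H$ be a directed graph (loops allowed, no multiple arcs) with $\Delta^-(H) = 1$, and let $H'$ be a retract of $H$. Then a directed graph $G$ has a $t$-frugal $H$-colouring if and only if $G$ has a $t$-frugal $H'$-colouring.
   Context: A homomorphism (or $H$-colouring) of a digraph $G$ to a digraph $H$ is a function $f: V(G) \to V(H)$ such that whenever $xy$ is an arc of $G$, $f(x)f(y)$ is an arc of $H$. For an integer $t \geq 1$, a homomorphism $f$ of $G$ to $H$ is $t$-frugal if for every vertex $v$ of $G$, no more than $t$ in-neighbours of $v$ have the same image under $f$. $\Delta^-(H)$ denotes the maximum in-degree of $H$. A subgraph $H'$ of $H$ is a retract of $H$ if there is a homomorphism $h$ from $H$ to $H'$ with $h(v) = v$ for every vertex $v$ of $H'$. -}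

module Defs where

open import Data.Nat using (ℕ; _≤_)
open import Data.Fin using (Fin)
open import Data.Fin.Properties using (_≟_)
open import Data.Bool using (Bool; true; _∧_)
open import Data.List using (List; filterᵇ; length)
open import Data.List.Base using ()
open import Data.Fin.Base using ()
open import Data.Product using (Σ; _×_; ∃)
open import Relation.Binary.PropositionalEquality using (_≡_)
open import Relation.Nullary.Decidable using (⌊_⌋)
open import Function.Definitions using (Injective)
open import Data.List using (allFin)

-- A finite digraph: vertex set Fin size, arcs given by a Boolean adjacency
-- relation (loops allowed, no multiple arcs).
record Digraph : Set where
  field
    size : ℕ
    arc  : Fin size → Fin size → Bool
open Digraph public

V : Digraph → Set
V G = Fin (size G)

Arc : (G : Digraph) → V G → V G → Set
Arc G x y = arc G x y ≡ true

inDeg : (G : Digraph) → V G → ℕ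
inDeg G v = length (filterᵇ (λ u → arc G u v) (allFin (size G)))

MaxInDegIs : Digraph → ℕ → Set
MaxInDegIs H k = ((v : V H) → inDeg H v ≤ k) × (Σ (V H) λ v → inDeg H v ≡ k)

IsHom : (G H : Digraph) → (V G → V H) → Set
IsHom G H f = ∀ x y → Arc G x y → Arc H (f x) (f y)

inNbrsColoured : (G : Digraph) (n : ℕ) → (V G → Fin n) → V G → Fin n → ℕ
inNbrsColoured G n f v c =
  length (filterᵇ (λ u → arc G u v ∧ ⌊ f u ≟ c ⌋) (allFin (size G)))

IsFrugal : (t : ℕ) (G H : Digraph) → (V G → V H) → Set
IsFrugal t G H f = (v : V G) (c : V H) → inNbrsColoured G (size H) f v c ≤ t

HasFrugalColouring : ℕ → Digraph → Digraph → Set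
HasFrugalColouring t G H = Σ (V G → V H) λ f → IsHom G H f × IsFrugal t G H f

IsSubgraphVia : (H' H : Digraph) → (V H' → V H) → Set
IsSubgraphVia H' H ι = Injective _≡_ _≡_ ι × IsHom H' H ι

IsRetractVia : (H' H : Digraph) → (V H' → V H) → Set
IsRetractVia H' H ι =
  IsSubgraphVia H' H ι × Σ (V H → V H') λ h → IsHom H H' h × (∀ v → h (ι v) ≡ v)

-- Every vertex of H has at most one in-neighbour, so a homomorphism f : G → H
-- sends all in-neighbours of a vertex v of G to the same vertex of H; if f is
-- t-frugal, v therefore has at most t in-neighbours.  Hence every colouring of G,
-- in particular the composite of f with the retraction H → H', is t-frugal.
-- Conversely, composing a t-frugal H'-colouring with the embedding ι merges no
-- colours, since ι has the retraction as a left inverse.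
module Submission where

open import Defs
open import Data.Bool using (Bool; T; _∧_)
open import Data.Bool.Properties using (T?; T-≡; T-∧)
open import Data.Fin using (Fin)
open import Data.Fin.Properties using (_≟_)
open import Data.List using (List; []; _∷_; length; filterᵇ; allFin)
open import Data.List.Membership.Propositional using (_∈_)
open import Data.List.Membership.Propositional.Properties using (∈-filter⁺; ∈-filter⁻; ∈-allFin)
open import Data.List.Relation.Binary.Sublist.Heterogeneous.Properties using (length-mono-≤)
open import Data.List.Relation.Binary.Sublist.Propositional using (⊆-refl)
open import Data.List.Relation.Binary.Sublist.Propositional.Properties using (filter⁺)
open import Data.List.Relation.Unary.Any using (here)
open import Data.Nat using (ℕ; _≤_; z≤n; s≤s)
open import Data.Nat.Properties using (≤-trans)
open import Data.Product using (_×_; _,_; proj₁; proj₂)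
open import Function using (_∘_; _⇔_; mk⇔; Equivalence)
open import Relation.Binary.PropositionalEquality using (_≡_; refl; sym; trans; cong)
open import Relation.Nullary.Decidable using (⌊_⌋; toWitness; fromWitness)

open Equivalence using (to; from)

private
  variable
    A : Set
    x y : A
    xs : List A
    n t : ℕ

length-filterᵇ-mono : {p q : A → Bool} → (∀ {x} → T (p x) → T (q x)) →
                      ∀ xs → length (filterᵇ p xs) ≤ length (filterᵇ q xs)
length-filterᵇ-mono {p = p} {q} p⇒q xs =
  length-mono-≤ (filter⁺ (T? ∘ p) (T? ∘ q) (λ { refl → p⇒q }) (⊆-refl {x = xs}))

∈-length≤1⇒≡ : length xs ≤ 1 → x ∈ xs → y ∈ xs → x ≡ y
∈-length≤1⇒≡ {xs = _ ∷ []} _ (here x≡z) (here y≡z) = trans x≡z (sym y≡z)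
∈-length≤1⇒≡ {xs = _ ∷ _ ∷ _} (s≤s ())

length≤-byMember : (∀ {x} → x ∈ xs → length xs ≤ n) → length xs ≤ n
length≤-byMember {xs = []}    _     = z≤n
length≤-byMember {xs = _ ∷ _} bound = bound (here refl)

inNeighbours : (G : Digraph) → V G → List (V G)
inNeighbours G v = filterᵇ (λ u → arc G u v) (allFin (size G))

module _ (G : Digraph) {u v : V G} where

  ∈-inNeighbours⁺ : Arc G u v → u ∈ inNeighbours G v
  ∈-inNeighbours⁺ uv = ∈-filter⁺ (T? ∘ λ w → arc G w v) (∈-allFin u) (from T-≡ uv)

  ∈-inNeighbours⁻ : u ∈ inNeighbours G v → Arc G u v
  ∈-inNeighbours⁻ u∈ = to T-≡ (proj₂ (∈-filter⁻ (T? ∘ λ w → arc G w v) {xs = allFin (size G)} u∈))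

module _ (G : Digraph) (v : V G) where

  T-colouredInNeighbour⇔ : ∀ {n} (f : V G → Fin n) c u →
                           T (arc G u v ∧ ⌊ f u ≟ c ⌋) ⇔ (Arc G u v × f u ≡ c)
  T-colouredInNeighbour⇔ f c u = mk⇔
    (λ t → let (uv , fu≡c) = to T-∧ t in to T-≡ uv , toWitness fu≡c)
    (λ (uv , fu≡c) → from T-∧ (from T-≡ uv , fromWitness fu≡c))

  inNbrsColoured-mono : ∀ {m n} {f : V G → Fin m} {g : V G → Fin n} {c d} →
                        (∀ {u} → Arc G u v → f u ≡ c → g u ≡ d) →
                        inNbrsColoured G m f v c ≤ inNbrsColoured G n g v d
  inNbrsColoured-mono {f = f} {g} {c} {d} f≡c⇒g≡d = length-filterᵇ-mono p⇒q (allFin (size G))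
    where
    p⇒q : ∀ {u} → T (arc G u v ∧ ⌊ f u ≟ c ⌋) → T (arc G u v ∧ ⌊ g u ≟ d ⌋)
    p⇒q {u} t = let (uv , fu≡c) = to (T-colouredInNeighbour⇔ f c u) t
                in from (T-colouredInNeighbour⇔ g d u) (uv , f≡c⇒g≡d uv fu≡c)

  inNbrsColoured≤inDeg : ∀ {n} (f : V G → Fin n) c → inNbrsColoured G n f v c ≤ inDeg G v
  inNbrsColoured≤inDeg f c = length-filterᵇ-mono (proj₁ ∘ to T-∧) (allFin (size G))

  inDeg≤inNbrsColoured : ∀ {n} {f : V G → Fin n} {c} → (∀ {u} → Arc G u v → f u ≡ c) →
                         inDeg G v ≤ inNbrsColoured G n f v c
  inDeg≤inNbrsColoured {f = f} {c} f≡c = length-filterᵇ-mono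
    (λ {u} t → from (T-colouredInNeighbour⇔ f c u) (to T-≡ t , f≡c (to T-≡ t)))
    (allFin (size G))

∘-isHom : ∀ {G H K : Digraph} {g : V H → V K} {f : V G → V H} →
          IsHom H K g → IsHom G H f → IsHom G K (g ∘ f)
∘-isHom g-hom f-hom x y xy = g-hom _ _ (f-hom x y xy)

inDeg≤1⇒inNeighbour-unique : ∀ {H : Digraph} → (∀ x → inDeg H x ≤ 1) →
                              ∀ {a b x} → Arc H a x → Arc H b x → a ≡ b
inDeg≤1⇒inNeighbour-unique {H} inDeg≤1 {x = x} ax bx =
  ∈-length≤1⇒≡ (inDeg≤1 x) (∈-inNeighbours⁺ H ax) (∈-inNeighbours⁺ H bx)

inDeg≤⇒frugal : ∀ {G H : Digraph} → (∀ v → inDeg G v ≤ t) → (f : V G → V H) → IsFrugal t G H f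
inDeg≤⇒frugal {G = G} inDeg≤t f v c = ≤-trans (inNbrsColoured≤inDeg G v f c) (inDeg≤t v)

frugal-hom⇒inDeg≤ : ∀ {G H : Digraph} {f : V G → V H} → (∀ x → inDeg H x ≤ 1) →
                    IsHom G H f → IsFrugal t G H f → ∀ v → inDeg G v ≤ t
frugal-hom⇒inDeg≤ {G = G} {f = f} inDeg≤1 f-hom f-frugal v =
  length≤-byMember λ {u} u∈ →
    ≤-trans (inDeg≤inNbrsColoured G v (λ wv → same-image wv (∈-inNeighbours⁻ G u∈)))
            (f-frugal v (f u))
  where
  same-image : ∀ {w u} → Arc G w v → Arc G u v → f w ≡ f u
  same-image wv uv = inDeg≤1⇒inNeighbour-unique inDeg≤1 (f-hom _ _ wv) (f-hom _ _ uv)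

frugal-∘-leftInvertible : ∀ {G H' H : Digraph} {f : V G → V H'} {ι : V H' → V H} {h : V H → V H'} →
                          (∀ x → h (ι x) ≡ x) → IsFrugal t G H' f → IsFrugal t G H (ι ∘ f)
frugal-∘-leftInvertible {G = G} {f = f} {h = h} h∘ι≗id f-frugal v c =
  ≤-trans (inNbrsColoured-mono G v (λ _ ιfu≡c → trans (sym (h∘ι≗id (f _))) (cong h ιfu≡c)))
          (f-frugal v (h c))

mainTheorem5 : (t : ℕ) → 2 ≤ t → (H H' : Digraph) → MaxInDegIs H 1 →
    (ι : V H' → V H) → IsRetractVia H' H ι →
    (G : Digraph) → HasFrugalColouring t G H ⇔ HasFrugalColouring t G H'
mainTheorem5 t _ H H' (inDeg≤1 , _) ι ((_ , ι-hom) , h , h-hom , h∘ι≗id) G = mk⇔ retract embed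
  where
  retract : HasFrugalColouring t G H → HasFrugalColouring t G H'
  retract (f , f-hom , f-frugal) =
    h ∘ f , ∘-isHom {G} {H} {H'} h-hom f-hom ,
    inDeg≤⇒frugal {G = G} {H'} (frugal-hom⇒inDeg≤ {G = G} {H} inDeg≤1 f-hom f-frugal) (h ∘ f)

  embed : HasFrugalColouring t G H' → HasFrugalColouring t G H
  embed (f , f-hom , f-frugal) =
    ι ∘ f , ∘-isHom {G} {H'} {H} ι-hom f-hom ,
    frugal-∘-leftInvertible {G = G} {H'} {H} {ι = ι} {h} h∘ι≗id f-frugal
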